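{- Let $r\geq 2$ and let $G$ be a multi $r$-edge-colored complete graph on $n$ vertices. Then at least $\big(1-\frac{r-2}{(r-1)^2}\big)\cdot n$ vertices of $G$ can be covered by $r-1$ monochromatic components of pairwise different colors, and this bound is sharp for infinitely many values of $r$. Moreover, the $r-1$ monochromatic components can be chosen so that their intersection is nonempty.
   Context: A complete graph $G$ is multi $r$-edge-colored if to each pair of distinct vertices $u,v$ a set $\emptyset\neq \mathrm{col}(uv)\subseteq [r]=\{1,\dots,r\}$ of colors is assigned, and the coloring is transitive: if $i\in \mathrm{col}(uv)\cap\mathrm{col}(vw)$ for distinct $u,v,w$, then $i\in\mathrm{col}(uw)$. The edge $uv$ has color $i$ if $i\in\mathrm{col}(uv)$. A monochromatic component of color $i$ is (the vertex set of) a connected component of the spanning subgraph of $G$ formed by the edges having color $i$ (a vertex incident to no edge of color $i$ forms a singleton component of color $i$). Sharpness means that for infinitely many $r$ there exist such $G$ in which no $r-1$ monochromatic components of pairwise different colors cover more than $\big(1-\frac{r-2}{(r-1)^2}\big)\cdot n$ vertices. -}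

module Defs where

open import Data.Nat using (ℕ; suc; _+_; _*_; _∸_; _≤_)
open import Data.Fin using (Fin)
open import Data.Bool using (Bool; true)
open import Data.List using (List; length)
open import Data.List.Membership.Propositional using (_∈_)
open import Data.List.Relation.Unary.Unique.Propositional using (Unique)
open import Data.Product using (Σ; ∃; _×_; _,_)
open import Function.Definitions using (Injective)
open import Relation.Binary.PropositionalEquality using (_≡_; _≢_)

-- A multi r-edge-colored complete graph on the vertex set Fin n.
-- col u v i ≡ true means colour i ∈ col(uv).  Values on the diagonal are irrelevant.
record MultiColoring (n r : ℕ) : Set where
  field
    col       : Fin n → Fin n → Fin r → Bool
    symmetric : ∀ u v i → col u v i ≡ col v u i
    nonempty  : ∀ u v → u ≢ v → ∃ λ i → col u v i ≡ true
    transitive : ∀ u v w i → u ≢ v → v ≢ w → u ≢ w →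
                 col u v i ≡ true → col v w i ≡ true → col u w i ≡ true
open MultiColoring public

HasColor : ∀ {n r} → MultiColoring n r → Fin r → Fin n → Fin n → Set
HasColor G i u v = (u ≢ v) × (col G u v i ≡ true)

data Reach {n r} (G : MultiColoring n r) (i : Fin r) (u : Fin n) : Fin n → Set where
  here : Reach G i u u
  step : ∀ {v w} → Reach G i u v → HasColor G i v w → Reach G i u w

-- The monochromatic component of colour i containing vertex v is {w | InComp G i v w}.
InComp : ∀ {n r} → MultiColoring n r → Fin r → Fin n → Fin n → Set
InComp = Reach

-- A choice of k monochromatic components of pairwise different colours:
-- component j has colour (colour j) and contains the vertex (rep j).
record CompChoice {n r} (G : MultiColoring n r) (k : ℕ) : Set where
  field
    colour   : Fin k → Fin r
    distinct : Injective _≡_ _≡_ colour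
    rep      : Fin k → Fin n
open CompChoice public

Covered : ∀ {n r k} {G : MultiColoring n r} → CompChoice G k → Fin n → Set
Covered {k = k} {G = G} C w = Σ (Fin k) λ j → InComp G (colour C j) (rep C j) w

CoversAtLeast : ∀ {n r k} {G : MultiColoring n r} → CompChoice G k → ℕ → Set
CoversAtLeast {n = n} C m =
  Σ (List (Fin n)) λ ws → Unique ws × (∀ w → w ∈ ws → Covered C w) × (m ≤ length ws)

CommonVertex : ∀ {n r k} {G : MultiColoring n r} → CompChoice G k → Set
CommonVertex {n = n} {k = k} {G = G} C =
  Σ (Fin n) λ x → ∀ (j : Fin k) → InComp G (colour C j) (rep C j) x

-- Let a_i(x) be the number of vertices w such that the edge xw carries colour i only.
-- The components at x of the r − 1 colours other than i cover every vertex except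
-- these, so it suffices to find x and i with (r−1)² a_i(x) ≤ (r−2) n. For r = 2 some
-- a_i(x) vanishes: exclusive edges xw, xz of both colours would leave no colour for wz.
-- For r ≥ 3 assume the contrary, write k = r − 1 and L = (k−1) n + 1, let K be the
-- colour-0 class of a vertex, s = |K| and t = n − s. Exclusive edges of non-zero colour
-- leave K, hence L ≤ k t. Double counting them against the largest number q of vertices
-- of K joined exclusively in one colour to one vertex z gives s L ≤ k² t q; and a vertex
-- of K so joined to z loses all q of them from its colour-0 exclusive neighbourhood,
-- hence L + k² q ≤ k² s. These three inequalities are incompatible.
--
-- For sharpness take r = p + 1 with p prime and colour each pair of points of the
-- affine plane over ℤ/p by the direction of the line through them. Components are lines,
-- and p lines of distinct directions all meet the first one, so they cover at most
-- p + (p − 1)² = p² − (p − 1) points.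

module Submission where

open import Defs
open import Data.Nat using (ℕ; zero; suc; pred; _+_; _*_; _∸_; _%_; _≤_; _<_; _≤?_; _<?_; z≤n; s≤s; NonZero; _!)
open import Data.Nat.Base using (nonTrivial⇒n>1)
open import Data.Nat.Properties
  using (_≟_; ≤-refl; ≤-reflexive; ≤-trans; ≤-<-trans; ≤-pred; <-cmp; <⇒≢; <⇒≱; ≮⇒≥; ≰⇒>; n≢0⇒n>0; n≤1+n;
         m≤n+m; m<m+n; m≤n⇒∃[o]m+o≡n; m+n∸m≡n; m+n∸n≡m; 1≤n!;
         +-comm; +-suc; +-mono-≤; +-monoˡ-≤; +-monoʳ-≤; +-cancelʳ-≤;
         *-comm; *-assoc; *-identityˡ; *-identityʳ; +-identityʳ; *-zeroʳ; *-distribˡ-+; *-distribʳ-∸; *-distribˡ-∸;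
         *-mono-≤; *-monoˡ-≤; *-monoʳ-≤; *-cancelˡ-≤; ∸-monoʳ-≤; +-*-semiring; module ≤-Reasoning)
open import Data.Nat.DivMod using (%-distribˡ-+; %-distribˡ-*; [m+kn]%n≡m%n; m%n%n≡m%n; m%n<n; m<n⇒m%n≡m)
open import Data.Nat.Divisibility using (_∣_; divides; ∣-trans; m∣m*n; ∣m+n∣m⇒∣n; ∣1⇒≡1; m≤n⇒m!∣n!)
open import Data.Nat.Coprimality using (coprime-Bézout; prime⇒coprime)
open import Data.Nat.GCD using (module Bézout)
open import Data.Nat.Primality using (Prime; prime⇒nonTrivial)
open import Data.Nat.Primality.Factorisation using (factorise)
open import Data.Nat.ListAction using (product)
open import Data.Nat.Tactic.RingSolver using (solve-∀)
open import Data.Fin using (Fin; zero; suc; toℕ; fromℕ<; remQuot; combine; punchIn; punchOut)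
open import Data.Fin.Properties
  using (suc-injective; any?; all?; 0≢1+n; punchIn-injective; punchIn-punchOut;
         toℕ<n; toℕ-injective; toℕ-fromℕ<; remQuot-combine; combine-remQuot)
  renaming (_≟_ to _≟ᶠ_)
open import Data.Bool using (true)
open import Data.Bool.Properties using () renaming (_≟_ to _≟ᵇ_)
open import Data.List using (List; []; _∷_; length; map; allFin; cartesianProduct)
open import Data.List.Properties using (length-map)
open import Data.List.Extrema.Nat using (argmax; f[xs]≤f[argmax])
open import Data.List.Membership.Propositional using (_∈_)
open import Data.List.Membership.Propositional.Properties using (∈-map⁻; ∈-allFin; ∈-cartesianProductWith⁺)
open import Data.List.Relation.Unary.Any using (here; there)
open import Data.List.Relation.Unary.All as All using ([]; _∷_)
open import Data.List.Relation.Unary.AllPairs using ([]; _∷_)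
open import Data.List.Relation.Unary.Unique.Propositional using (Unique)
import Data.List.Relation.Unary.Unique.Propositional.Properties as Unique
open import Data.Product using (Σ; ∃; _×_; _,_; proj₁; proj₂; uncurry)
open import Data.Sum using (_⊎_; inj₁; inj₂)
open import Data.Empty using (⊥; ⊥-elim)
open import Data.Unit using (⊤; tt)
open import Function using (_∘_; mk⇔)
open import Level using (Level)
open import Relation.Binary.Definitions using (tri<; tri≈; tri>)
open import Relation.Binary.PropositionalEquality
open import Relation.Nullary using (Dec; yes; no; does; ¬_; ¬?; _×-dec_; _⊎-dec_; _→-dec_)
open import Relation.Nullary.Decidable using (dec-true; does-⇔)
open import Relation.Unary using (Pred; Decidable; _⊆_; ∁; _∩_)
open import Relation.Unary.Properties using (∁?; _∩?_)
open import Algebra.Properties.Semiring.Sum +-*-semiring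
  using (sum-syntax; sum; ∑-distrib-+; ∑-comm; *-distribˡ-sum; sum-cong-≗)

private variable
  ℓ ℓ′ : Level
  n m : ℕ

-- Counting on Fin n

∑-mono-≤ : {f g : Fin n → ℕ} → (∀ i → f i ≤ g i) → sum f ≤ sum g
∑-mono-≤ {zero} f≤g = z≤n
∑-mono-≤ {suc n} f≤g = +-mono-≤ (f≤g zero) (∑-mono-≤ (λ i → f≤g (suc i)))

∑-const : ∀ n c → ∑[ i < n ] c ≡ n * c
∑-const zero c = refl
∑-const (suc n) c = cong (c +_) (∑-const n c)

∑-*ʳ : (f : Fin n → ℕ) (c : ℕ) → ∑[ i < n ] (f i * c) ≡ sum f * c
∑-*ʳ f c = begin
  ∑[ i < _ ] (f i * c)  ≡⟨ sum-cong-≗ (λ i → *-comm (f i) c) ⟩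
  ∑[ i < _ ] (c * f i)  ≡⟨ *-distribˡ-sum c f ⟨
  c * sum f             ≡⟨ *-comm c (sum f) ⟩
  sum f * c             ∎
  where open ≡-Reasoning

indicator : ∀ {A : Set ℓ} → Dec A → ℕ
indicator (yes _) = 1
indicator (no _)  = 0

count : {P : Pred (Fin n) ℓ} → Decidable P → ℕ
count {n = n} P? = ∑[ x < n ] indicator (P? x)

count-∩-∁ : {P : Pred (Fin n) ℓ} {Q : Pred (Fin n) ℓ′} (P? : Decidable P) (Q? : Decidable Q) →
            count P? ≡ count (P? ∩? Q?) + count (P? ∩? ∁? Q?)
count-∩-∁ {n = n} P? Q? = trans (sum-cong-≗ split) (∑-distrib-+ {n} _ _)
  where
  split : ∀ x → indicator (P? x) ≡ indicator ((P? ∩? Q?) x) + indicator ((P? ∩? ∁? Q?) x)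
  split x with P? x | Q? x
  ... | yes _ | yes _ = refl
  ... | yes _ | no _  = refl
  ... | no _  | yes _ = refl
  ... | no _  | no _  = refl

P⇒0<count : {P : Pred (Fin n) ℓ} (P? : Decidable P) → ∀ {x} → P x → 0 < count P?
P⇒0<count P? {zero} px with P? zero
... | yes _ = s≤s z≤n
... | no ¬px = ⊥-elim (¬px px)
P⇒0<count P? {suc x} px = ≤-trans (P⇒0<count (λ y → P? (suc y)) px) (m≤n+m _ (indicator (P? zero)))

0<count⇒∃ : {P : Pred (Fin n) ℓ} (P? : Decidable P) → 0 < count P? → ∃ P
0<count⇒∃ {n = suc n} P? pos with P? zero
... | yes p₀ = zero , p₀
... | no _ with 0<count⇒∃ (λ y → P? (suc y)) pos
...   | x , px = suc x , px

count-mono : {P : Pred (Fin n) ℓ} {Q : Pred (Fin n) ℓ′} (P? : Decidable P) (Q? : Decidable Q) →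
             P ⊆ Q → count P? ≤ count Q?
count-mono P? Q? P⊆Q = ∑-mono-≤ pointwise
  where
  pointwise : ∀ x → indicator (P? x) ≤ indicator (Q? x)
  pointwise x with P? x | Q? x
  ... | yes px | no ¬qx = ⊥-elim (¬qx (P⊆Q px))
  ... | yes _  | yes _  = ≤-refl
  ... | no _   | _      = z≤n

count-∁ : {P : Pred (Fin n) ℓ} (P? : Decidable P) → count P? + count (∁? P?) ≡ n
count-∁ {n = n} P? = begin
  count P? + count (∁? P?)                          ≡⟨ ∑-distrib-+ {n} _ _ ⟨
  ∑[ x < n ] (indicator (P? x) + indicator (∁? P? x)) ≡⟨ sum-cong-≗ one ⟩
  ∑[ x < n ] 1                                      ≡⟨ ∑-const n 1 ⟩
  n * 1                                             ≡⟨ *-identityʳ n ⟩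
  n                                                 ∎
  where
  open ≡-Reasoning
  one : ∀ x → indicator (P? x) + indicator (∁? P? x) ≡ 1
  one x with P? x
  ... | yes _ = refl
  ... | no _  = refl

count-none : {P : Pred (Fin n) ℓ} (P? : Decidable P) → (∀ x → ¬ P x) → count P? ≡ 0
count-none {n = n} P? none = trans (sum-cong-≗ zero-at) (trans (∑-const n 0) (*-zeroʳ n))
  where
  zero-at : ∀ x → indicator (P? x) ≡ 0
  zero-at x with P? x
  ... | yes px = ⊥-elim (none x px)
  ... | no _   = refl

count-≤1 : {P : Pred (Fin n) ℓ} (P? : Decidable P) → (∀ {x y} → P x → P y → x ≡ y) → count P? ≤ 1
count-≤1 {n = zero} P? unique = z≤n
count-≤1 {n = suc n} P? unique with P? zero
... | yes p₀ = ≤-reflexive (cong suc (count-none (λ y → P? (suc y)) (λ y py → 0≢1+n (unique p₀ py))))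
... | no _ = count-≤1 (λ y → P? (suc y)) (λ px py → suc-injective (unique px py))

Unique⇒length≤count : {P : Pred (Fin n) ℓ} (P? : Decidable P) {ws : List (Fin n)} →
                      Unique ws → (∀ {w} → w ∈ ws → P w) → length ws ≤ count P?
Unique⇒length≤count P? {[]} _ _ = z≤n
Unique⇒length≤count {P = P} P? {x ∷ ws} (x∉ws ∷ unique) ws⊆P = begin
  suc (length ws)                         ≤⟨ s≤s (Unique⇒length≤count (P? ∩? ∁? (x ≟ᶠ_)) unique rest) ⟩
  suc (count (P? ∩? ∁? (x ≟ᶠ_)))           ≤⟨ +-monoˡ-≤ _ (P⇒0<count (P? ∩? (x ≟ᶠ_)) (ws⊆P (here refl) , refl)) ⟩
  count (P? ∩? (x ≟ᶠ_)) + count (P? ∩? ∁? (x ≟ᶠ_)) ≡⟨ count-∩-∁ P? (x ≟ᶠ_) ⟨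
  count P?                                ∎
  where
  open ≤-Reasoning
  rest : ∀ {w} → w ∈ ws → (P ∩ ∁ (x ≡_)) w
  rest w∈ws = ws⊆P (there w∈ws) , λ x≡w → All.lookup x∉ws w∈ws x≡w

enumerate : {P : Pred (Fin n) ℓ} (P? : Decidable P) →
            ∃ λ ws → Unique ws × (∀ {w} → w ∈ ws → P w) × length ws ≡ count P?
enumerate {n = zero} P? = [] , [] , (λ ()) , refl
enumerate {n = suc n} {P = P} P? with enumerate (λ y → P? (suc y))
... | ws , unique , ws⊆P , len with P? zero
...   | yes p₀ = zero ∷ map suc ws , zero∉ ∷ unique′ , ⊆P , cong suc len′
  where
  zero∉ : All.All (zero ≢_) (map suc ws)
  zero∉ = All.tabulate λ w∈ → case-suc (∈-map⁻ suc w∈)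
    where
    case-suc : ∀ {w} → ∃ (λ v → v ∈ ws × w ≡ suc v) → zero ≢ w
    case-suc (_ , _ , refl) ()
  unique′ = Unique.map⁺ suc-injective unique
  ⊆P : ∀ {w} → w ∈ zero ∷ map suc ws → P w
  ⊆P (here refl) = p₀
  ⊆P (there w∈) with ∈-map⁻ suc w∈
  ... | _ , v∈ , refl = ws⊆P v∈
  len′ = trans (length-map suc ws) len
...   | no _ = map suc ws , Unique.map⁺ suc-injective unique , ⊆P , trans (length-map suc ws) len
  where
  ⊆P : ∀ {w} → w ∈ map suc ws → P w
  ⊆P w∈ with ∈-map⁻ suc w∈
  ... | _ , v∈ , refl = ws⊆P v∈

count≤-injectiveOn : {P : Pred (Fin n) ℓ} (P? : Decidable P) (f : Fin n → Fin m) →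
                     (∀ {x y} → P x → P y → f x ≡ f y → x ≡ y) → count P? ≤ m
count≤-injectiveOn {n = n} {m = m} {P = P} P? f injective with enumerate P?
... | ws , unique , ws⊆P , len = begin
  count P?                 ≡⟨ len ⟨
  length ws                ≡⟨ length-map f ws ⟨
  length (map f ws)        ≤⟨ Unique⇒length≤count ⊤? (map⁺ unique ws⊆P) (λ _ → tt) ⟩
  count ⊤?                 ≡⟨ trans (∑-const m 1) (*-identityʳ m) ⟩
  m                        ∎
  where
  open ≤-Reasoning
  ⊤? : Decidable {A = Fin m} (λ _ → ⊤)
  ⊤? _ = yes tt
  map⁺ : ∀ {vs} → Unique vs → (∀ {w} → w ∈ vs → P w) → Unique (map f vs)
  map⁺ {[]} [] _ = []
  map⁺ {v ∷ vs} (v∉vs ∷ unique) vs⊆P =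
    All.tabulate fv∉ ∷ map⁺ unique (λ w∈ → vs⊆P (there w∈))
    where
    fv∉ : ∀ {y} → y ∈ map f vs → f v ≢ y
    fv∉ y∈ fv≡y with ∈-map⁻ f y∈
    ... | w , w∈ , refl = All.lookup v∉vs w∈ (injective (vs⊆P (here refl)) (vs⊆P (there w∈)) fv≡y)

count-⋃ : ∀ {k} {P : Fin (suc k) → Pred (Fin n) ℓ} (P? : ∀ j → Decidable (P j)) →
          count (λ x → any? (λ j → P? j x)) ≤
          count (P? zero) + ∑[ j < k ] count (P? (suc j) ∩? ∁? (P? zero))
count-⋃ {n = n} {k = k} {P = P} P? = begin
  count (λ x → any? (λ j → P? j x))
    ≤⟨ ∑-mono-≤ pointwise ⟩
  ∑[ x < n ] (indicator (P? zero x) + ∑[ j < k ] indicator ((P? (suc j) ∩? ∁? (P? zero)) x))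
    ≡⟨ ∑-distrib-+ {n} _ _ ⟩
  count (P? zero) + ∑[ x < n ] ∑[ j < k ] indicator ((P? (suc j) ∩? ∁? (P? zero)) x)
    ≡⟨ cong (count (P? zero) +_) (∑-comm {n} {k} _) ⟩
  count (P? zero) + ∑[ j < k ] count (P? (suc j) ∩? ∁? (P? zero)) ∎
  where
  open ≤-Reasoning
  pointwise : ∀ x → indicator (any? (λ j → P? j x)) ≤
                    indicator (P? zero x) + ∑[ j < k ] indicator ((P? (suc j) ∩? ∁? (P? zero)) x)
  pointwise x = split (any? (λ j → P? j x)) (P? zero x)
    where
    split : (d : Dec (∃ λ j → P j x)) (d₀ : Dec (P zero x)) →
            indicator d ≤ indicator d₀ + ∑[ j < k ] indicator (P? (suc j) x ×-dec ¬? d₀)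
    split (no _)             _          = z≤n
    split (yes _)            (yes _)    = s≤s z≤n
    split (yes (zero , p₀))  (no ¬p₀)   = ⊥-elim (¬p₀ p₀)
    split (yes (suc j , pⱼ)) d₀@(no ¬p₀) = P⇒0<count (λ j → P? (suc j) x ×-dec ¬? d₀) (pⱼ , ¬p₀)

∃-maximum₂ : ∀ {k} (f : Fin n → Fin k → ℕ) → Fin n → Fin k →
             ∃ λ x → ∃ λ y → ∀ x′ y′ → f x′ y′ ≤ f x y
∃-maximum₂ {n = n} {k = k} f x₀ y₀ = proj₁ best , proj₂ best , λ x y →
  All.lookup (f[xs]≤f[argmax] (x₀ , y₀) pairs) (∈-cartesianProductWith⁺ _,_ (∈-allFin x) (∈-allFin y))
  where
  pairs = cartesianProduct (allFin n) (allFin k)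
  best = argmax (uncurry f) (x₀ , y₀) pairs

count-∩-∁-≤ : {P : Pred (Fin n) ℓ} {Q : Pred (Fin n) ℓ′} (P? : Decidable P) (Q? : Decidable Q) →
              count P? ≤ suc m → ∃ (P ∩ Q) → count (P? ∩? ∁? Q?) ≤ m
count-∩-∁-≤ {m = m} P? Q? P≤1+m (_ , pq) = ≤-pred (begin
  suc (count (P? ∩? ∁? Q?))                   ≤⟨ +-monoˡ-≤ _ (P⇒0<count (P? ∩? Q?) pq) ⟩
  count (P? ∩? Q?) + count (P? ∩? ∁? Q?)      ≡⟨ count-∩-∁ P? Q? ⟨
  count P?                                    ≤⟨ P≤1+m ⟩
  suc m                                       ∎)
  where open ≤-Reasoning

-- Exclusive colours and colour classes

module _ {n r} (G : MultiColoring n r) where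

  private variable
    i j : Fin r
    u v w x : Fin n

  hasColor? : ∀ i u → Decidable (HasColor G i u)
  hasColor? i u v = ¬? (u ≟ᶠ v) ×-dec (col G u v i ≟ᵇ true)

  HasColor-sym : HasColor G i u v → HasColor G i v u
  HasColor-sym {i} {u} {v} (u≢v , uv) = u≢v ∘ sym , trans (symmetric G v u i) uv

  HasColor-trans : HasColor G i u v → HasColor G i v w → u ≢ w → HasColor G i u w
  HasColor-trans {i} {u} {v} {w} (u≢v , uv) (v≢w , vw) u≢w = u≢w , transitive G u v w i u≢v v≢w u≢w uv vw

  Exclusive : Fin r → Fin n → Fin n → Set
  Exclusive i u v = HasColor G i u v × (∀ j → col G u v j ≡ true → j ≡ i)

  exclusive? : ∀ i u → Decidable (Exclusive i u)
  exclusive? i u v = hasColor? i u v ×-dec all? (λ j → (col G u v j ≟ᵇ true) →-dec (j ≟ᶠ i))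

  exclusiveDegree : Fin r → Fin n → ℕ
  exclusiveDegree i x = count (exclusive? i x)

  Exclusive-unique : Exclusive i u v → Exclusive j u v → i ≡ j
  Exclusive-unique (_ , only-i) ((_ , uv-j) , _) = sym (only-i _ uv-j)

  ¬Exclusive⇒otherColour : u ≢ v → ¬ Exclusive i u v → ∃ λ j → j ≢ i × col G u v j ≡ true
  ¬Exclusive⇒otherColour {u} {v} {i} u≢v ¬excl
    with any? (λ j → ¬? (j ≟ᶠ i) ×-dec (col G u v j ≟ᵇ true))
  ... | yes other = other
  ... | no ¬other = ⊥-elim (¬excl ((u≢v , uv-i) , only-i))
    where
    only-i : ∀ j → col G u v j ≡ true → j ≡ i
    only-i j uv-j with j ≟ᶠ i
    ... | yes j≡i = j≡i
    ... | no j≢i = ⊥-elim (¬other (j , j≢i , uv-j))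
    uv-i : col G u v i ≡ true
    uv-i with c , uv-c ← nonempty G u v u≢v = subst (λ c → col G u v c ≡ true) (only-i c uv-c) uv-c

  -- By transitivity this is the colour-i component of x.
  ColourClass : Fin r → Fin n → Pred (Fin n) _
  ColourClass i x w = x ≡ w ⊎ HasColor G i x w

  colourClass? : ∀ i x → Decidable (ColourClass i x)
  colourClass? i x w = (x ≟ᶠ w) ⊎-dec hasColor? i x w

  ColourClass-edge : ColourClass i x u → ColourClass i x v → u ≢ v → HasColor G i u v
  ColourClass-edge (inj₁ refl) (inj₁ refl) u≢v = ⊥-elim (u≢v refl)
  ColourClass-edge (inj₁ refl) (inj₂ xv)   u≢v = xv
  ColourClass-edge (inj₂ xu)   (inj₁ refl) u≢v = HasColor-sym xu
  ColourClass-edge (inj₂ xu)   (inj₂ xv)   u≢v = HasColor-trans (HasColor-sym xu) xv u≢v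

  ColourClass-closed : ColourClass i x u → HasColor G i u v → ColourClass i x v
  ColourClass-closed (inj₁ refl) uv = inj₂ uv
  ColourClass-closed {x = x} {v = v} (inj₂ xu) uv with x ≟ᶠ v
  ... | yes x≡v = inj₁ x≡v
  ... | no x≢v  = inj₂ (HasColor-trans xu uv x≢v)

module _ {n k} (G : MultiColoring n (suc (suc k))) where

  componentsAtExcept : Fin n → Fin (suc (suc k)) → CompChoice G (suc k)
  componentsAtExcept x i = record
    { colour   = punchIn i
    ; distinct = punchIn-injective i _ _
    ; rep      = λ _ → x
    }

  componentsAtExcept-covers : ∀ x i {w} → ¬ Exclusive G i x w → Covered (componentsAtExcept x i) w
  componentsAtExcept-covers x i {w} ¬excl with x ≟ᶠ w
  ... | yes refl = zero , here
  ... | no x≢w with ¬Exclusive⇒otherColour G x≢w ¬excl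
  ...   | j , j≢i , xw-j = punchOut i≢j , step here (x≢w , xw-colour)
    where
    i≢j = j≢i ∘ sym
    xw-colour : col G x w (punchIn i (punchOut i≢j)) ≡ true
    xw-colour = subst (λ c → col G x w c ≡ true) (sym (punchIn-punchOut i≢j)) xw-j

  componentsAtExcept-coversAtLeast : ∀ x i → CoversAtLeast (componentsAtExcept x i) (n ∸ exclusiveDegree G i x)
  componentsAtExcept-coversAtLeast x i with enumerate (∁? (exclusive? G i x))
  ... | ws , unique , ws⊆ , len =
    ws , unique , (λ w w∈ → componentsAtExcept-covers x i (ws⊆ w∈)) , ≤-reflexive len′
    where
    len′ : n ∸ exclusiveDegree G i x ≡ length ws
    len′ = trans (cong (_∸ exclusiveDegree G i x) (sym (count-∁ (exclusive? G i x))))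
                 (trans (m+n∸m≡n (exclusiveDegree G i x) _) (sym len))

  componentsAtExcept-commonVertex : ∀ x i → CommonVertex (componentsAtExcept x i)
  componentsAtExcept-commonVertex x i = x , λ _ → here

-- The lower bound

*-∸-≤ : ∀ c d n a → c * a ≤ d * n → (c ∸ d) * n ≤ c * (n ∸ a)
*-∸-≤ c d n a ca≤dn = begin
  (c ∸ d) * n    ≡⟨ *-distribʳ-∸ n c d ⟩
  c * n ∸ d * n  ≤⟨ ∸-monoʳ-≤ (c * n) ca≤dn ⟩
  c * n ∸ c * a  ≡⟨ *-distribˡ-∸ c n a ⟨
  c * (n ∸ a)    ∎
  where open ≤-Reasoning

mix-bounds : ∀ L c s t q → s * L ≤ c * t * q → L + c * q ≤ c * s → L * (s + t) ≤ c * s * t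
mix-bounds L c s t q sL≤ctq L+cq≤cs = begin
  L * (s + t)          ≡⟨ distrib L s t ⟩
  L * t + s * L        ≤⟨ +-monoʳ-≤ (L * t) sL≤ctq ⟩
  L * t + c * t * q    ≡⟨ collect L c t q ⟩
  (L + c * q) * t      ≤⟨ *-monoˡ-≤ t L+cq≤cs ⟩
  c * s * t            ∎
  where
  open ≤-Reasoning
  distrib : ∀ L s t → L * (s + t) ≡ L * t + s * L
  distrib = solve-∀
  collect : ∀ L c t q → L * t + c * t * q ≡ (L + c * q) * t
  collect = solve-∀

square-gap : ∀ e s t → suc e * s < t →
             suc (suc e) * suc (suc e) * s * t < suc (suc e * (s + t)) * (s + t)
square-gap e s t k′s<t with d , refl ← m≤n⇒∃[o]m+o≡n k′s<t =
  subst (suc (suc e) * suc (suc e) * s * t <_) (expand e s d) (m<m+n _ (s≤s z≤n))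
  where
  expand : ∀ e s d → let t = suc (suc e * s + d) in
    suc (suc e) * suc (suc e) * s * t + suc (s + (suc e * s + d) + suc d * (e * t + e * s + suc d))
    ≡ suc (suc e * (s + t)) * (s + t)
  expand = solve-∀

-- The last two give L (s + t) ≤ k² s t, while the first gives t > (k − 1) s,
-- which forces L (s + t) > k² s t.
dense-impossible : ∀ {k′} → 0 < k′ → ∀ s t q {n} → s + t ≡ n → let k = suc k′; L = suc (k′ * n) in
                   L ≤ k * t → s * L ≤ k * k * t * q → L + k * k * q ≤ k * k * s → ⊥
dense-impossible {suc e} _ s t q refl L≤k*t sL≤kktq L+kkq≤kks =
  <⇒≱ (square-gap e s t k′s<t) (mix-bounds L (k * k) s t q sL≤kktq L+kkq≤kks)
  where
  k′ = suc e
  k = suc k′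
  L = suc (k′ * (s + t))
  k′s<t : k′ * s < t
  k′s<t = +-cancelʳ-≤ (k′ * t) (suc (k′ * s)) t (begin
    suc (k′ * s) + k′ * t  ≡⟨ cong suc (*-distribˡ-+ k′ s t) ⟨
    L                      ≤⟨ L≤k*t ⟩
    t + k′ * t             ∎)
    where open ≤-Reasoning

module Dense {N k′} (G : MultiColoring N (suc (suc k′))) (x₀ : Fin N)
             (dense : ∀ x i → k′ * N < suc k′ * suc k′ * exclusiveDegree G i x) where

  k L : ℕ
  k = suc k′
  L = suc (k′ * N)

  a : Fin (suc k) → Fin N → ℕ
  a = exclusiveDegree G

  K : Pred (Fin N) _
  K = ColourClass G zero x₀

  K? : Decidable K
  K? = colourClass? G zero x₀

  s t : ℕ
  s = count K?
  t = count (∁? K?)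

  K-noExclusiveOther : ∀ {u v j} → K u → K v → ¬ Exclusive G (suc j) u v
  K-noExclusiveOther u∈K v∈K ((u≢v , _) , only)
    with () ← only zero (proj₂ (ColourClass-edge G u∈K v∈K u≢v))

  -- Exclusive neighbours of w in non-zero colours lie outside K, each in a single colour.
  ∑a≤t : ∀ {w} → K w → ∑[ j < k ] a (suc j) w ≤ t
  ∑a≤t {w} w∈K = begin
    ∑[ j < k ] a (suc j) w                             ≡⟨ ∑-comm {k} {N} (λ j z → indicator (excl? j z)) ⟩
    ∑[ z < N ] count (λ j → excl? j z)                 ≤⟨ ∑-mono-≤ atMostOneOutside ⟩
    t                                                  ∎
    where
    open ≤-Reasoning
    excl? = λ j → exclusive? G (suc j) w
    atMostOneOutside : ∀ z → count (λ j → excl? j z) ≤ indicator (∁? K? z)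
    atMostOneOutside z with K? z
    ... | yes z∈K = ≤-reflexive (count-none (λ j → excl? j z) (λ _ → K-noExclusiveOther w∈K z∈K))
    ... | no _    = count-≤1 (λ j → excl? j z) (λ e₁ e₂ → suc-injective (Exclusive-unique G e₁ e₂))

  k*L≤k*k*∑a : ∀ w → k * L ≤ k * k * ∑[ j < k ] a (suc j) w
  k*L≤k*k*∑a w = begin
    k * L                            ≡⟨ ∑-const k L ⟨
    ∑[ j < k ] L                     ≤⟨ ∑-mono-≤ (λ j → dense w (suc j)) ⟩
    ∑[ j < k ] (k * k * a (suc j) w) ≡⟨ *-distribˡ-sum (k * k) (λ j → a (suc j) w) ⟨
    k * k * ∑[ j < k ] a (suc j) w   ∎
    where open ≤-Reasoning

  L≤k*t : L ≤ k * t
  L≤k*t = *-cancelˡ-≤ k (begin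
    k * L                             ≤⟨ k*L≤k*k*∑a x₀ ⟩
    k * k * ∑[ j < k ] a (suc j) x₀   ≤⟨ *-monoʳ-≤ (k * k) (∑a≤t (inj₁ refl)) ⟩
    k * k * t                         ≡⟨ *-assoc k k t ⟩
    k * (k * t)                       ∎)
    where open ≤-Reasoning

  q : Fin N → Fin k → ℕ
  q z j = count (K? ∩? λ w → exclusive? G (suc j) w z)

  ∑q≤t*k*m : ∀ {m} → (∀ z j → q z j ≤ m) → ∑[ z < N ] ∑[ j < k ] q z j ≤ t * (k * m)
  ∑q≤t*k*m {m} q≤m = begin
    ∑[ z < N ] ∑[ j < k ] q z j                  ≤⟨ ∑-mono-≤ outside ⟩
    ∑[ z < N ] (indicator (∁? K? z) * (k * m))   ≡⟨ ∑-*ʳ (λ z → indicator (∁? K? z)) (k * m) ⟩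
    t * (k * m)                                  ∎
    where
    open ≤-Reasoning
    outside : ∀ z → ∑[ j < k ] q z j ≤ indicator (∁? K? z) * (k * m)
    outside z with K? z
    ... | yes z∈K = ≤-reflexive (trans (sum-cong-≗ none) (trans (∑-const k 0) (*-zeroʳ k)))
      where
      none : ∀ j → q z j ≡ 0
      none j = count-none (K? ∩? λ w → exclusive? G (suc j) w z)
                          (λ w (w∈K , excl) → K-noExclusiveOther w∈K z∈K excl)
    ... | no _ = begin
      ∑[ j < k ] q z j   ≤⟨ ∑-mono-≤ (q≤m z) ⟩
      ∑[ j < k ] m       ≡⟨ ∑-const k m ⟩
      k * m              ≡⟨ +-identityʳ (k * m) ⟨
      1 * (k * m)        ∎

  E : Fin N → Fin k → Fin N → ℕ
  E w j z = indicator (K? w ×-dec exclusive? G (suc j) w z)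

  double-count : ∑[ w < N ] ∑[ j < k ] ∑[ z < N ] E w j z ≡ ∑[ z < N ] ∑[ j < k ] q z j
  double-count = begin
    ∑[ w < N ] ∑[ j < k ] ∑[ z < N ] E w j z   ≡⟨ ∑-comm {N} {k} (λ w j → ∑[ z < N ] E w j z) ⟩
    ∑[ j < k ] ∑[ w < N ] ∑[ z < N ] E w j z   ≡⟨ sum-cong-≗ (λ j → ∑-comm {N} {N} (λ w z → E w j z)) ⟩
    ∑[ j < k ] ∑[ z < N ] ∑[ w < N ] E w j z   ≡⟨ ∑-comm {k} {N} (λ j z → ∑[ w < N ] E w j z) ⟩
    ∑[ z < N ] ∑[ j < k ] q z j                ∎
    where open ≡-Reasoning

  s*L≤k*k*t*m : ∀ {m} → (∀ z j → q z j ≤ m) → s * L ≤ k * k * t * m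
  s*L≤k*k*t*m {m} q≤m = *-cancelˡ-≤ k (begin
    k * (s * L)                                       ≡⟨ pull-out ⟩
    ∑[ w < N ] (indicator (K? w) * (k * L))           ≤⟨ ∑-mono-≤ fromK ⟩
    ∑[ w < N ] (k * k * ∑[ j < k ] ∑[ z < N ] E w j z) ≡⟨ *-distribˡ-sum (k * k) (λ w → ∑[ j < k ] ∑[ z < N ] E w j z) ⟨
    k * k * ∑[ w < N ] ∑[ j < k ] ∑[ z < N ] E w j z  ≡⟨ cong (k * k *_) double-count ⟩
    k * k * ∑[ z < N ] ∑[ j < k ] q z j               ≤⟨ *-monoʳ-≤ (k * k) (∑q≤t*k*m q≤m) ⟩
    k * k * (t * (k * m))                             ≡⟨ rearrange k t m ⟩
    k * (k * k * t * m)                               ∎)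
    where
    open ≤-Reasoning
    swap-left : ∀ a b c → a * (b * c) ≡ b * (a * c)
    swap-left = solve-∀
    rearrange : ∀ k t m → k * k * (t * (k * m)) ≡ k * (k * k * t * m)
    rearrange = solve-∀
    pull-out : k * (s * L) ≡ ∑[ w < N ] (indicator (K? w) * (k * L))
    pull-out = trans (swap-left k s L) (sym (∑-*ʳ (λ w → indicator (K? w)) (k * L)))
    fromK : ∀ w → indicator (K? w) * (k * L) ≤ k * k * ∑[ j < k ] ∑[ z < N ] E w j z
    fromK w with K? w
    ... | no _ = z≤n
    ... | yes w∈K = begin
      1 * (k * L)                      ≡⟨ *-identityˡ (k * L) ⟩
      k * L                            ≤⟨ k*L≤k*k*∑a w ⟩
      k * k * ∑[ j < k ] a (suc j) w   ≤⟨ *-monoʳ-≤ (k * k) (∑-mono-≤ λ j → count-mono (exclusive? G (suc j) w) (Eʷ j) (w∈K ,_)) ⟩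
      k * k * ∑[ j < k ] count (Eʷ j)  ∎
      where
      Eʷ = λ j z → yes w∈K ×-dec exclusive? G (suc j) w z

  z* : Fin N
  z* = proj₁ (∃-maximum₂ q x₀ zero)

  j* : Fin k
  j* = proj₁ (proj₂ (∃-maximum₂ q x₀ zero))

  qmax : ℕ
  qmax = q z* j*

  q≤qmax : ∀ z j → q z j ≤ qmax
  q≤qmax = proj₂ (proj₂ (∃-maximum₂ q x₀ zero))

  0<qmax : 0 < qmax
  0<qmax = n≢0⇒n>0 λ qmax≡0 → <⇒≱ 0<s*L (begin
    s * L              ≤⟨ s*L≤k*k*t*m q≤qmax ⟩
    k * k * t * qmax   ≡⟨ cong (k * k * t *_) qmax≡0 ⟩
    k * k * t * 0      ≡⟨ *-zeroʳ (k * k * t) ⟩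
    0                  ∎)
    where
    open ≤-Reasoning
    0<s*L : 0 < s * L
    0<s*L = *-mono-≤ (P⇒0<count K? (inj₁ refl)) (s≤s z≤n)

  Q? : Decidable (λ w → Exclusive G (suc j*) w z*)
  Q? w = exclusive? G (suc j*) w z*

  w* : Fin N
  w* = proj₁ (0<count⇒∃ (K? ∩? Q?) 0<qmax)

  w*∈K : K w*
  w*∈K = proj₁ (proj₂ (0<count⇒∃ (K? ∩? Q?) 0<qmax))

  w*z*-exclusive : Exclusive G (suc j*) w* z*
  w*z*-exclusive = proj₂ (proj₂ (0<count⇒∃ (K? ∩? Q?) 0<qmax))

  -- A colour-0 exclusive neighbour y of w* lies in K, and y z* is not exclusive in
  -- colour suc j*: otherwise w* y would carry that colour as well.
  a₀+qmax≤s : a zero w* + qmax ≤ s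
  a₀+qmax≤s = begin
    a zero w* + qmax              ≤⟨ +-monoˡ-≤ qmax (count-mono (exclusive? G zero w*) (K? ∩? ∁? Q?) inside) ⟩
    count (K? ∩? ∁? Q?) + qmax    ≡⟨ +-comm _ qmax ⟩
    qmax + count (K? ∩? ∁? Q?)    ≡⟨ count-∩-∁ K? Q? ⟨
    s                             ∎
    where
    open ≤-Reasoning
    suc≢zero : ∀ {j : Fin k} → suc j ≢ zero
    suc≢zero ()
    inside : ∀ {y} → Exclusive G zero w* y → K y × ¬ Exclusive G (suc j*) y z*
    inside ((w*≢y , w*y) , only-zero) = ColourClass-closed G w*∈K (w*≢y , w*y) , λ yz* →
      suc≢zero (only-zero (suc j*)
        (proj₂ (HasColor-trans G (proj₁ w*z*-exclusive) (HasColor-sym G (proj₁ yz*)) w*≢y)))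

  L+k*k*qmax≤k*k*s : L + k * k * qmax ≤ k * k * s
  L+k*k*qmax≤k*k*s = begin
    L + k * k * qmax                   ≤⟨ +-monoˡ-≤ (k * k * qmax) (dense w* zero) ⟩
    k * k * a zero w* + k * k * qmax   ≡⟨ *-distribˡ-+ (k * k) (a zero w*) qmax ⟨
    k * k * (a zero w* + qmax)         ≤⟨ *-monoʳ-≤ (k * k) a₀+qmax≤s ⟩
    k * k * s                          ∎
    where open ≤-Reasoning

  absurd : 0 < k′ → ⊥
  absurd 0<k′ = dense-impossible 0<k′ s t qmax (count-∁ K?) L≤k*t (s*L≤k*k*t*m q≤qmax) L+k*k*qmax≤k*k*s

-- wz needs a colour, and either colour would propagate to x.
twoColours-exclusive : ∀ {n} (G : MultiColoring n 2) {x w z} →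
                       Exclusive G zero x w → Exclusive G (suc zero) x z → ⊥
twoColours-exclusive G {x} {w} {z} (xw , only-0) (xz , only-1) with w ≟ᶠ z
... | yes refl = 0≢1+n (sym (only-0 (suc zero) (proj₂ xz)))
... | no w≢z with nonempty G w z w≢z
...   | zero , wz = 0≢1+n (only-1 zero (proj₂ (HasColor-trans G xw (w≢z , wz) (proj₁ xz))))
...   | suc zero , wz = 0≢1+n (sym (only-0 (suc zero) (proj₂ (HasColor-trans G xz (HasColor-sym G (w≢z , wz)) (proj₁ xw)))))

twoColours-sparse : ∀ {n} (G : MultiColoring (suc n) 2) → ∃ λ i → exclusiveDegree G i zero ≡ 0
twoColours-sparse G with exclusiveDegree G zero zero ≟ 0 | exclusiveDegree G (suc zero) zero ≟ 0
... | yes a₀≡0 | _        = zero , a₀≡0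
... | no _     | yes a₁≡0 = suc zero , a₁≡0
... | no a₀≢0  | no a₁≢0  = ⊥-elim (twoColours-exclusive G (proj₂ (witness a₀≢0)) (proj₂ (witness a₁≢0)))
  where
  witness : ∀ {i} → exclusiveDegree G i zero ≢ 0 → ∃ (Exclusive G i zero)
  witness {i} a≢0 = 0<count⇒∃ (exclusive? G i zero) (n≢0⇒n>0 a≢0)

sparseExclusive-manyColours : ∀ {n k′} (G : MultiColoring (suc n) (suc (suc k′))) → 0 < k′ →
                              ∃ λ x → ∃ λ i → suc k′ * suc k′ * exclusiveDegree G i x ≤ k′ * suc n
sparseExclusive-manyColours {n} {k′} G 0<k′
  with any? (λ x → any? (λ i → suc k′ * suc k′ * exclusiveDegree G i x ≤? k′ * suc n))
... | yes sparse = sparse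
... | no ¬sparse = ⊥-elim (Dense.absurd G zero (λ x i → ≰⇒> λ le → ¬sparse (x , i , le)) 0<k′)

sparseExclusive : ∀ {n k′} (G : MultiColoring (suc n) (suc (suc k′))) →
                  ∃ λ x → ∃ λ i → suc k′ * suc k′ * exclusiveDegree G i x ≤ k′ * suc n
sparseExclusive {k′ = zero} G with i , a≡0 ← twoColours-sparse G =
  zero , i , ≤-reflexive (trans (*-identityˡ _) a≡0)
sparseExclusive {k′ = suc _} G = sparseExclusive-manyColours G (s≤s z≤n)

lowerBound : (r n : ℕ) → 2 ≤ r → 1 ≤ n → (G : MultiColoring n r) →
  Σ (CompChoice G (r ∸ 1)) λ C →
    Σ ℕ (λ m → CoversAtLeast C m × (((r ∸ 1) * (r ∸ 1) ∸ (r ∸ 2)) * n ≤ (r ∸ 1) * (r ∸ 1) * m))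
    × CommonVertex C
lowerBound (suc (suc k′)) (suc n) _ _ G with x , i , sparse ← sparseExclusive G =
  componentsAtExcept G x i ,
  (suc n ∸ exclusiveDegree G i x , componentsAtExcept-coversAtLeast G x i ,
   *-∸-≤ (suc k′ * suc k′) k′ (suc n) (exclusiveDegree G i x) sparse) ,
  componentsAtExcept-commonVertex G x i
lowerBound (suc zero) _ (s≤s ()) _ _
lowerBound _ zero _ () _

-- Arithmetic modulo a prime

module _ (p : ℕ) .{{_ : NonZero p}} where

  %-+-congˡ : ∀ a b c → b % p ≡ c % p → (a + b) % p ≡ (a + c) % p
  %-+-congˡ a b c b≡c = begin
    (a + b) % p            ≡⟨ %-distribˡ-+ a b p ⟩
    (a % p + b % p) % p    ≡⟨ cong (λ x → (a % p + x) % p) b≡c ⟩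
    (a % p + c % p) % p    ≡⟨ %-distribˡ-+ a c p ⟨
    (a + c) % p            ∎
    where open ≡-Reasoning

  %-+-congʳ : ∀ a b c → a % p ≡ b % p → (a + c) % p ≡ (b + c) % p
  %-+-congʳ a b c a≡b = begin
    (a + c) % p            ≡⟨ %-distribˡ-+ a c p ⟩
    (a % p + c % p) % p    ≡⟨ cong (λ x → (x + c % p) % p) a≡b ⟩
    (b % p + c % p) % p    ≡⟨ %-distribˡ-+ b c p ⟨
    (b + c) % p            ∎
    where open ≡-Reasoning

  %-*-congˡ : ∀ a b c → b % p ≡ c % p → (a * b) % p ≡ (a * c) % p
  %-*-congˡ a b c b≡c = begin
    (a * b) % p            ≡⟨ %-distribˡ-* a b p ⟩
    (a % p * (b % p)) % p  ≡⟨ cong (λ x → (a % p * x) % p) b≡c ⟩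
    (a % p * (c % p)) % p  ≡⟨ %-distribˡ-* a c p ⟨
    (a * c) % p            ∎
    where open ≡-Reasoning

  %-*-congʳ : ∀ a b c → a % p ≡ b % p → (a * c) % p ≡ (b * c) % p
  %-*-congʳ a b c a≡b = begin
    (a * c) % p  ≡⟨ cong (_% p) (*-comm a c) ⟩
    (c * a) % p  ≡⟨ %-*-congˡ c a b a≡b ⟩
    (c * b) % p  ≡⟨ cong (_% p) (*-comm c b) ⟩
    (b * c) % p  ∎
    where open ≡-Reasoning

  %-injective : ∀ {a b} → a < p → b < p → a % p ≡ b % p → a ≡ b
  %-injective {a} {b} a<p b<p a≡b = trans (sym (m<n⇒m%n≡m a<p)) (trans a≡b (m<n⇒m%n≡m b<p))

module _ (p′ : ℕ) where

  private
    p : ℕ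
    p = suc p′

  %-+-cancelʳ : ∀ a b c → (a + c) % p ≡ (b + c) % p → a % p ≡ b % p
  %-+-cancelʳ a b c a+c≡b+c = begin
    a % p                    ≡⟨ [m+kn]%n≡m%n a c p ⟨
    (a + c * p) % p          ≡⟨ cong (_% p) (regroup a c p′) ⟩
    (a + c + p′ * c) % p     ≡⟨ %-+-congʳ p (a + c) (b + c) (p′ * c) a+c≡b+c ⟩
    (b + c + p′ * c) % p     ≡⟨ cong (_% p) (regroup b c p′) ⟨
    (b + c * p) % p          ≡⟨ [m+kn]%n≡m%n b c p ⟩
    b % p                    ∎
    where
    open ≡-Reasoning
    regroup : ∀ a c p′ → a + c * suc p′ ≡ a + c + p′ * c
    regroup = solve-∀

  module _ (prime : Prime p) where

    inverse : ∀ {d} → 0 < d → d < p → ∃ λ u → (d * u) % p ≡ 1 % p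
    inverse {d@(suc _)} _ d<p with coprime-Bézout (prime⇒coprime prime d<p)
    ... | Bézout.-+ x y 1+xp≡yd = y , (begin
      (d * y) % p        ≡⟨ cong (_% p) (trans (*-comm d y) (sym 1+xp≡yd)) ⟩
      (1 + x * p) % p    ≡⟨ [m+kn]%n≡m%n 1 x p ⟩
      1 % p              ∎)
      where open ≡-Reasoning
    -- Here d y ≡ −1, so y p′ inverts d.
    ... | Bézout.+- x y 1+yd≡xp = y * p′ , (begin
      (d * (y * p′)) % p             ≡⟨ [m+kn]%n≡m%n (d * (y * p′)) x p ⟨
      (d * (y * p′) + x * p) % p     ≡⟨ cong (λ z → (d * (y * p′) + z) % p) 1+yd≡xp ⟨
      (d * (y * p′) + (1 + y * d)) % p ≡⟨ cong (_% p) (regroup d y p′) ⟩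
      (1 + (y * d) * p) % p          ≡⟨ [m+kn]%n≡m%n 1 (y * d) p ⟩
      1 % p                          ∎)
      where
      open ≡-Reasoning
      regroup : ∀ d y p′ → d * (y * p′) + (1 + y * d) ≡ 1 + y * d * suc p′
      regroup = solve-∀

    -- x = u (b − a), with −a represented by p′ a.
    solve-linear : ∀ {d} → 0 < d → d < p → ∀ a b → ∃ λ x → x < p × (a + d * x) % p ≡ b % p
    solve-linear {d} 0<d d<p a b with u , du≡1 ← inverse 0<d d<p =
      x , m%n<n c p , (begin
        (a + d * x) % p                  ≡⟨ %-+-congˡ p a (d * x) (d * c) (%-*-congˡ p d (c % p) c (m%n%n≡m%n c p)) ⟩
        (a + d * c) % p                  ≡⟨ cong (λ z → (a + z) % p) (*-assoc d u (b + p′ * a)) ⟨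
        (a + d * u * (b + p′ * a)) % p   ≡⟨ %-+-congˡ p a _ _ (%-*-congʳ p (d * u) 1 (b + p′ * a) du≡1) ⟩
        (a + 1 * (b + p′ * a)) % p       ≡⟨ cong (_% p) (regroup a b p′) ⟩
        (b + a * p) % p                  ≡⟨ [m+kn]%n≡m%n b a p ⟩
        b % p                            ∎)
      where
      open ≡-Reasoning
      regroup : ∀ a b p′ → a + 1 * (b + p′ * a) ≡ b + a * suc p′
      regroup = solve-∀
      c = u * (b + p′ * a)
      x = c % p

-- The affine plane over ℤ/p

dec-true⁻¹ : ∀ {A : Set ℓ} (a? : Dec A) → does a? ≡ true → A
dec-true⁻¹ (yes a) _ = a

module AffinePlane (p′ : ℕ) (prime : Prime (suc p′)) where

  p : ℕ
  p = suc p′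

  1<p : 1 < p
  1<p = nonTrivial⇒n>1 p {{prime⇒nonTrivial prime}}

  Point : Set
  Point = Fin (p * p)

  coordinates : Point → Fin p × Fin p
  coordinates = remQuot {p} p

  X Y : Point → ℕ
  X v = toℕ (proj₁ (coordinates v))
  Y v = toℕ (proj₂ (coordinates v))

  X<p : ∀ v → X v < p
  X<p v = toℕ<n (proj₁ (coordinates v))

  Y<p : ∀ v → Y v < p
  Y<p v = toℕ<n (proj₂ (coordinates v))

  coordinates-injective : ∀ {u v} → X u ≡ X v → Y u ≡ Y v → u ≡ v
  coordinates-injective {u} {v} Xu≡Xv Yu≡Yv = begin
    u                            ≡⟨ combine-remQuot {p} p u ⟨
    uncurry combine (coordinates u) ≡⟨ cong₂ combine (toℕ-injective Xu≡Xv) (toℕ-injective Yu≡Yv) ⟩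
    uncurry combine (coordinates v) ≡⟨ combine-remQuot {p} p v ⟩
    v                            ∎
    where open ≡-Reasoning

  point : ∀ {x y} → x < p → y < p → ∃ λ v → X v ≡ x × Y v ≡ y
  point x<p y<p = v , trans (cong (toℕ ∘ proj₁) coords) (toℕ-fromℕ< x<p)
                    , trans (cong (toℕ ∘ proj₂) coords) (toℕ-fromℕ< y<p)
    where
    v = combine (fromℕ< x<p) (fromℕ< y<p)
    coords = remQuot-combine {p} {p} (fromℕ< x<p) (fromℕ< y<p)

  -- Direction zero consists of the vertical lines x = const,
  -- direction suc b of the lines y + b x = const (mod p).
  intercept : Fin (suc p) → Point → ℕ
  intercept zero    v = X v
  intercept (suc b) v = Y v + toℕ b * X v

  OnLine : Fin (suc p) → Point → Point → Set
  OnLine c u v = intercept c u % p ≡ intercept c v % p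

  onLine? : ∀ c u → Decidable (OnLine c u)
  onLine? c u v = intercept c u % p ≟ intercept c v % p

  gap : ∀ {a b} → a < b → b < p → ∃ λ d → 0 < d × d < p × a + d ≡ b
  gap {a} a<b b<p with d , refl ← m≤n⇒∃[o]m+o≡n a<b =
    suc d , s≤s z≤n , ≤-<-trans (s≤s (m≤n+m d a)) b<p , +-suc a d

  affinePlane : MultiColoring (p * p) (suc p)
  affinePlane = record
    { col        = λ u v c → does (onLine? c u v)
    ; symmetric  = λ u v c → does-⇔ (mk⇔ sym sym) (onLine? c u v) (onLine? c v u)
    ; nonempty   = λ u v _ → let c , uv = line-through u v in c , dec-true (onLine? c u v) uv
    ; transitive = λ u v w c _ _ _ uv vw →
        dec-true (onLine? c u w) (trans (dec-true⁻¹ (onLine? c u v) uv) (dec-true⁻¹ (onLine? c v w) vw))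
    }
    where
    sloped-line : ∀ {u v} → X u < X v → ∃ λ c → OnLine c u v
    sloped-line {u} {v} Xu<Xv =
      let d , 0<d , d<p , Xu+d≡Xv = gap Xu<Xv (X<p v)
          b , b<p , Yv+db≡Yu = solve-linear p′ prime 0<d d<p (Y v) (Y u)
      in suc (fromℕ< b<p) , (begin
        (Y u + toℕ (fromℕ< b<p) * X u) % p  ≡⟨ cong (λ z → (Y u + z * X u) % p) (toℕ-fromℕ< b<p) ⟩
        (Y u + b * X u) % p                ≡⟨ %-+-congʳ p (Y u) (Y v + d * b) (b * X u) (sym Yv+db≡Yu) ⟩
        (Y v + d * b + b * X u) % p        ≡⟨ cong (_% p) (regroup (Y v) d b (X u)) ⟩
        (Y v + b * (X u + d)) % p          ≡⟨ cong (λ z → (Y v + b * z) % p) Xu+d≡Xv ⟩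
        (Y v + b * X v) % p                ≡⟨ cong (λ z → (Y v + z * X v) % p) (toℕ-fromℕ< b<p) ⟨
        (Y v + toℕ (fromℕ< b<p) * X v) % p ∎)
      where
      open ≡-Reasoning
      regroup : ∀ y d b x → y + d * b + b * x ≡ y + b * (x + d)
      regroup = solve-∀

    line-through : ∀ u v → ∃ λ c → OnLine c u v
    line-through u v with <-cmp (X u) (X v)
    ... | tri< Xu<Xv _ _ = sloped-line {u} {v} Xu<Xv
    ... | tri≈ _ Xu≡Xv _ = zero , cong (_% p) Xu≡Xv
    ... | tri> _ _ Xv<Xu = let c , vu = sloped-line {v} {u} Xv<Xu in c , sym vu

  Reach⇒OnLine : ∀ {c u w} → Reach affinePlane c u w → OnLine c u w
  Reach⇒OnLine here = refl
  Reach⇒OnLine {c} (step {v} {w} u→v (_ , vw)) = trans (Reach⇒OnLine u→v) (dec-true⁻¹ (onLine? c v w) vw)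

  Meet : Fin (suc p) → Point → Fin (suc p) → Point → Set
  Meet c₁ r₁ c₂ r₂ = ∃ λ w → OnLine c₁ r₁ w × OnLine c₂ r₂ w

  Meet-sym : ∀ {c₁ r₁ c₂ r₂} → Meet c₁ r₁ c₂ r₂ → Meet c₂ r₂ c₁ r₁
  Meet-sym (w , on₁ , on₂) = w , on₂ , on₁

  vertical-meets-sloped : ∀ b r₁ r₂ → Meet zero r₁ (suc b) r₂
  vertical-meets-sloped b r₁ r₂ =
    let y , y<p , hy = solve-linear p′ prime (s≤s z≤n) 1<p (toℕ b * X r₁) (intercept (suc b) r₂)
        w , Xw≡x , Yw≡y = point (X<p r₁) y<p
    in w , cong (_% p) (sym Xw≡x) , (begin
      intercept (suc b) r₂ % p        ≡⟨ hy ⟨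
      (toℕ b * X r₁ + 1 * y) % p      ≡⟨ cong (_% p) (swap (toℕ b * X r₁) y) ⟩
      (y + toℕ b * X r₁) % p          ≡⟨ cong₂ (λ y′ x′ → (y′ + toℕ b * x′) % p) Yw≡y Xw≡x ⟨
      (Y w + toℕ b * X w) % p         ∎)
    where
    open ≡-Reasoning
    swap : ∀ a y → a + 1 * y ≡ y + a
    swap = solve-∀

  sloped-meets-steeper : ∀ {b₁ b₂ : Fin p} → toℕ b₁ < toℕ b₂ → ∀ r₁ r₂ → Meet (suc b₁) r₁ (suc b₂) r₂
  sloped-meets-steeper {b₁} {b₂} b₁<b₂ r₁ r₂ =
    let e , 0<e , e<p , b₁+e≡b₂ = gap b₁<b₂ (toℕ<n b₂)
        x , x<p , hx = solve-linear p′ prime 0<e e<p ℓ₁ ℓ₂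
        y , y<p , hy = solve-linear p′ prime (s≤s z≤n) 1<p (B₁ * x) ℓ₁
        w , Xw≡x , Yw≡y = point x<p y<p
        on-w : ∀ B → (y + B * x) % p ≡ (Y w + B * X w) % p
        on-w B = cong₂ (λ y′ x′ → (y′ + B * x′) % p) (sym Yw≡y) (sym Xw≡x)
    in w , (begin
      ℓ₁ % p                     ≡⟨ hy ⟨
      (B₁ * x + 1 * y) % p       ≡⟨ cong (_% p) (swap (B₁ * x) y) ⟩
      (y + B₁ * x) % p           ≡⟨ on-w B₁ ⟩
      intercept (suc b₁) w % p   ∎) , (begin
      ℓ₂ % p                     ≡⟨ hx ⟨
      (ℓ₁ + e * x) % p           ≡⟨ %-+-congʳ p ℓ₁ (B₁ * x + 1 * y) (e * x) (sym hy) ⟩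
      (B₁ * x + 1 * y + e * x) % p ≡⟨ cong (_% p) (regroup B₁ x y e) ⟩
      (y + (B₁ + e) * x) % p     ≡⟨ cong (λ z → (y + z * x) % p) b₁+e≡b₂ ⟩
      (y + B₂ * x) % p           ≡⟨ on-w B₂ ⟩
      intercept (suc b₂) w % p   ∎)
    where
    open ≡-Reasoning
    B₁ = toℕ b₁
    B₂ = toℕ b₂
    ℓ₁ = intercept (suc b₁) r₁
    ℓ₂ = intercept (suc b₂) r₂
    swap : ∀ a y → a + 1 * y ≡ y + a
    swap = solve-∀
    regroup : ∀ b x y e → b * x + 1 * y + e * x ≡ y + (b + e) * x
    regroup = solve-∀

  lines-meet : ∀ {c₁ c₂} → c₁ ≢ c₂ → ∀ r₁ r₂ → Meet c₁ r₁ c₂ r₂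
  lines-meet {zero}   {zero}   c₁≢c₂ _ _ = ⊥-elim (c₁≢c₂ refl)
  lines-meet {zero}   {suc b}  _ r₁ r₂ = vertical-meets-sloped b r₁ r₂
  lines-meet {suc b}  {zero}   _ r₁ r₂ = Meet-sym {zero} {r₂} {suc b} {r₁} (vertical-meets-sloped b r₂ r₁)
  lines-meet {suc b₁} {suc b₂} c₁≢c₂ r₁ r₂ with <-cmp (toℕ b₁) (toℕ b₂)
  ... | tri< b₁<b₂ _ _ = sloped-meets-steeper b₁<b₂ r₁ r₂
  ... | tri≈ _ b₁≡b₂ _ = ⊥-elim (c₁≢c₂ (cong suc (toℕ-injective b₁≡b₂)))
  ... | tri> _ _ b₂<b₁ = Meet-sym {suc b₂} {r₂} {suc b₁} {r₁} (sloped-meets-steeper b₂<b₁ r₂ r₁)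

  line-size : ∀ c r → count (onLine? c r) ≤ p
  line-size zero r = count≤-injectiveOn (onLine? zero r) (proj₂ ∘ coordinates) λ {u} {v} ru rv Yu≡Yv →
    coordinates-injective (%-injective p (X<p u) (X<p v) (trans (sym ru) rv)) (cong toℕ Yu≡Yv)
  line-size (suc b) r = count≤-injectiveOn (onLine? (suc b) r) (proj₁ ∘ coordinates) λ {u} {v} ru rv Xu≡Xv →
    coordinates-injective (cong toℕ Xu≡Xv) (%-injective p (Y<p u) (Y<p v)
      (%-+-cancelʳ p′ (Y u) (Y v) (toℕ b * X u)
        (trans (sym ru) (trans rv (cong (λ x → (Y v + toℕ b * x) % p) (sym (cong toℕ Xu≡Xv)))))))

  module _ (C : CompChoice affinePlane p) where

    Line : Fin p → Point → Set
    Line j = OnLine (colour C j) (rep C j)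

    line? : ∀ j → Decidable (Line j)
    line? j = onLine? (colour C j) (rep C j)

    new-points≤p′ : ∀ j → count (line? (suc j) ∩? ∁? (line? zero)) ≤ p′
    new-points≤p′ j = count-∩-∁-≤ (line? (suc j)) (line? zero) (line-size (colour C (suc j)) (rep C (suc j)))
      (lines-meet (λ c≡c → 0≢1+n (sym (distinct C c≡c))) (rep C (suc j)) (rep C zero))

    covered≤ : ∀ m → CoversAtLeast C m → m ≤ p + p′ * p′
    covered≤ m (ws , unique , covered , m≤|ws|) = begin
      m                                           ≤⟨ m≤|ws| ⟩
      length ws                                   ≤⟨ Unique⇒length≤count (λ w → any? (λ j → line? j w)) unique onSomeLine ⟩
      count (λ w → any? (λ j → line? j w))        ≤⟨ count-⋃ line? ⟩
      count (line? zero) + ∑[ j < p′ ] count (line? (suc j) ∩? ∁? (line? zero))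
                                                  ≤⟨ +-mono-≤ (line-size (colour C zero) (rep C zero)) (∑-mono-≤ new-points≤p′) ⟩
      p + ∑[ j < p′ ] p′                          ≡⟨ cong (p +_) (∑-const p′ p′) ⟩
      p + p′ * p′                                 ∎
      where
      open ≤-Reasoning
      onSomeLine : ∀ {w} → w ∈ ws → ∃ λ j → Line j w
      onSomeLine w∈ws = let j , reach = covered _ w∈ws in j , Reach⇒OnLine reach

-- Sharpness

open AffinePlane using (affinePlane; covered≤)

-- Any prime factor of m! + 1 exceeds m.
prime-above : ∀ m → ∃ λ p′ → m ≤ p′ × Prime (suc p′)
prime-above m with factorise (suc (m !))
... | record { factors = [] ; isFactorisation = 1+m!≡1 } = ⊥-elim (<⇒≢ (1≤n! m) (sym (cong pred 1+m!≡1)))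
... | record { factors = q ∷ qs ; isFactorisation = 1+m!≡qΠ ; factorsPrime = prime-q ∷ _ } with m <? q
...   | yes (s≤s m≤q′) = _ , m≤q′ , prime-q
...   | no m≮q = ⊥-elim (<⇒≢ 1<q (sym (∣1⇒≡1 q∣1)))
  where
  1<q : 1 < q
  1<q = nonTrivial⇒n>1 q {{prime⇒nonTrivial prime-q}}
  q∣q! : ∀ {q} → 1 < q → q ∣ q !
  q∣q! {suc q′} _ = m∣m*n (q′ !)
  q∣1 : q ∣ 1
  q∣1 = ∣m+n∣m⇒∣n (divides (product qs) (trans (+-comm (m !) 1) (trans 1+m!≡qΠ (*-comm q (product qs)))))
                   (∣-trans (q∣q! 1<q) (m≤n⇒m!∣n! (≮⇒≥ m≮q)))

sharpness : (r₀ : ℕ) → Σ ℕ λ r → r₀ ≤ r × 2 ≤ r × Σ ℕ λ n → 1 ≤ n × Σ (MultiColoring n r) λ G →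
  (C : CompChoice G (r ∸ 1)) → (m : ℕ) → CoversAtLeast C m →
    ((r ∸ 1) * (r ∸ 1)) * m ≤ ((r ∸ 1) * (r ∸ 1) ∸ (r ∸ 2)) * n
sharpness r₀ with p′ , r₀≤p′ , prime-p ← prime-above r₀ =
  suc (suc p′) , ≤-trans r₀≤p′ (≤-trans (n≤1+n p′) (n≤1+n (suc p′))) , s≤s (s≤s z≤n) ,
  p * p , s≤s z≤n , affinePlane p′ prime-p , bound
  where
  p = suc p′
  bound : (C : CompChoice (affinePlane p′ prime-p) p) (m : ℕ) → CoversAtLeast C m →
          p * p * m ≤ (p * p ∸ p′) * (p * p)
  bound C m covers = begin
    p * p * m                ≤⟨ *-monoʳ-≤ (p * p) (covered≤ p′ prime-p C m covers) ⟩
    p * p * (p + p′ * p′)    ≡⟨ cong (p * p *_) (trans (sym (m+n∸n≡m _ p′)) (cong (_∸ p′) (square p′))) ⟩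
    p * p * (p * p ∸ p′)     ≡⟨ *-comm (p * p) _ ⟩
    (p * p ∸ p′) * (p * p)   ∎
    where
    open ≤-Reasoning
    square : ∀ p′ → suc p′ + p′ * p′ + p′ ≡ suc p′ * suc p′
    square = solve-∀

theorem5 :
    ((r n : ℕ) → 2 ≤ r → 1 ≤ n → (G : MultiColoring n r) →
      Σ (CompChoice G (r ∸ 1)) λ C →
        Σ ℕ (λ m → CoversAtLeast C m ×
          (((r ∸ 1) * (r ∸ 1) ∸ (r ∸ 2)) * n ≤ (r ∸ 1) * (r ∸ 1) * m))
        × CommonVertex C)
    ×
    ((r₀ : ℕ) → Σ ℕ λ r → r₀ ≤ r × 2 ≤ r × Σ ℕ λ n → 1 ≤ n × Σ (MultiColoring n r) λ G →
      (C : CompChoice G (r ∸ 1)) → (m : ℕ) → CoversAtLeast C m →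
        ((r ∸ 1) * (r ∸ 1)) * m ≤ ((r ∸ 1) * (r ∸ 1) ∸ (r ∸ 2)) * n)
theorem5 = lowerBound , sharpness
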